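{- Let $q$ be a prime power and let $\alpha\in\mathbb{F}_{q^{n}}$ satisfy $\mathbb{F}_{q^{n}}=\mathbb{F}_{q}(\alpha)$. Then every Galois conjugate $\beta$ of $\alpha$ (over $\mathbb{F}_q$) also satisfies $\mathbb{F}_{q^{n}}=\mathbb{F}_{q}(\beta)$, and the design whose blocks are the $r$-dimensional $\alpha$-splitting subspaces of $\mathbb{F}_{q^{n}}$ is isomorphic to the design whose blocks are the $r$-dimensional $\beta$-splitting subspaces of $\mathbb{F}_{q^{n}}$.
   Context: A design over $\mathbb{F}_q$ here consists of an $n$-dimensional $\mathbb{F}_q$-vector space $V$ together with a set $\mathcal{B}$ of $k$-dimensional subspaces (blocks); a $t$-$(n,k,\lambda;q)$ design is one in which every $t$-dimensional subspace of $V$ lies in exactly $\lambda$ blocks. For $\gamma\in\mathbb{F}_{q^{n}}$, an $\mathbb{F}_q$-subspace $W\subseteq\mathbb{F}_{q^{n}}$ is $\gamma$-splitting if $\mathbb{F}_{q^{n}}=W\oplus\gamma W\oplus\cdots\oplus\gamma^{n-1}W$. -}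

module Defs where

open import Level using (Level; _⊔_; Lift) renaming (suc to lsuc)
open import Algebra.Bundles using (CommutativeRing)
open import Data.Nat using (ℕ; zero; suc; _≤_; _^_)
open import Data.Nat.Primality using (Prime)
open import Data.Fin using (Fin; toℕ) renaming (zero to fzero; suc to fsuc)
open import Data.Product using (Σ; ∃; ∃-syntax; _×_; _,_)
open import Data.Unit using (⊤)
open import Relation.Nullary using (¬_)
open import Relation.Binary.PropositionalEquality using (_≡_)

IsPrimePower : ℕ → Set
IsPrimePower q = ∃[ p ] ∃[ k ] (Prime p × 1 ≤ k × q ≡ p ^ k)

record Field c ℓ : Set (lsuc (c ⊔ ℓ)) where
  field
    commutativeRing : CommutativeRing c ℓ
  open CommutativeRing commutativeRing public
  field
    1≉0     : ¬ (1# ≈ 0#)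
    inverse : ∀ x → ¬ (x ≈ 0#) → ∃[ y ] (x * y ≈ 1#)

module _ {c ℓ} (F : Field c ℓ) where
  open Field F

  Subset : Set (lsuc (c ⊔ ℓ))
  Subset = Carrier → Set (c ⊔ ℓ)

  Respects : Subset → Set (c ⊔ ℓ)
  Respects P = ∀ {x y} → x ≈ y → P x → P y

  sumF : ∀ {m} → (Fin m → Carrier) → Carrier
  sumF {zero}  f = 0#
  sumF {suc m} f = f fzero + sumF (λ i → f (fsuc i))

  pow : Carrier → ℕ → Carrier
  pow γ zero    = 1#
  pow γ (suc k) = γ * pow γ k

  HasSize : Subset → ℕ → Set (c ⊔ ℓ)
  HasSize P m =
    Σ (Fin m → Carrier) λ f →
      (∀ i → P (f i)) ×
      (∀ i j → f i ≈ f j → i ≡ j) ×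
      (∀ x → P x → ∃[ i ] (f i ≈ x))

  FieldHasSize : ℕ → Set (c ⊔ ℓ)
  FieldHasSize m = HasSize (λ _ → Lift (c ⊔ ℓ) ⊤) m

  IsSubfield : Subset → Set (c ⊔ ℓ)
  IsSubfield K =
    Respects K × K 0# × K 1# ×
    (∀ x y → K x → K y → K (x + y)) ×
    (∀ x y → K x → K y → K (x * y)) ×
    (∀ x → K x → K (- x)) ×
    (∀ x → K x → ¬ (x ≈ 0#) → ∃[ y ] (K y × x * y ≈ 1#))

  -- F = K(α): the only subfield of F containing K and α is F itself
  Generates : Subset → Carrier → Set (lsuc (c ⊔ ℓ))
  Generates K α =
    (L : Subset) → IsSubfield L → (∀ x → K x → L x) → L α → ∀ x → L x

  -- β is a Galois conjugate of α over K: β = σ(α) for a field automorphism σ of F fixing K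
  IsGaloisConjugate : Subset → Carrier → Carrier → Set (c ⊔ ℓ)
  IsGaloisConjugate K α β =
    Σ (Carrier → Carrier) λ σ →
      (∀ x y → x ≈ y → σ x ≈ σ y) ×
      (∀ x y → σ (x + y) ≈ σ x + σ y) ×
      (∀ x y → σ (x * y) ≈ σ x * σ y) ×
      (σ 1# ≈ 1#) ×
      (∀ x y → σ x ≈ σ y → x ≈ y) ×
      (∀ y → ∃[ x ] (σ x ≈ y)) ×
      (∀ x → K x → σ x ≈ x) ×
      (β ≈ σ α)

  IsSubspace : Subset → Subset → Set (c ⊔ ℓ)
  IsSubspace K W =
    Respects W × W 0# ×
    (∀ x y → W x → W y → W (x + y)) ×
    (∀ a x → K a → W x → W (a * x))

  HasDim : Subset → Subset → ℕ → Set (c ⊔ ℓ)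
  HasDim K W r =
    Σ (Fin r → Carrier) λ b →
      (∀ i → W (b i)) ×
      (∀ (a : Fin r → Carrier) → (∀ i → K (a i)) →
         sumF (λ i → a i * b i) ≈ 0# → ∀ i → a i ≈ 0#) ×
      (∀ x → W x → Σ (Fin r → Carrier) λ a →
         (∀ i → K (a i)) × x ≈ sumF (λ i → a i * b i))

  -- W is γ-splitting in F (of degree n over K):  F = W ⊕ γW ⊕ ⋯ ⊕ γ^(n-1) W
  IsSplitting : ℕ → Carrier → Subset → Set (c ⊔ ℓ)
  IsSplitting n γ W =
    (∀ x → Σ (Fin n → Carrier) λ w →
       (∀ i → W (w i)) × x ≈ sumF (λ i → pow γ (toℕ i) * w i)) ×
    (∀ (w w′ : Fin n → Carrier) → (∀ i → W (w i)) → (∀ i → W (w′ i)) →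
       sumF (λ i → pow γ (toℕ i) * w i) ≈ sumF (λ i → pow γ (toℕ i) * w′ i) →
       ∀ i → w i ≈ w′ i)

  SplittingBlock : Subset → ℕ → ℕ → Carrier → Subset → Set (c ⊔ ℓ)
  SplittingBlock K n r γ W = IsSubspace K W × HasDim K W r × IsSplitting n γ W

  image : (Carrier → Carrier) → Subset → Subset
  image φ W y = ∃[ x ] (W x × φ x ≈ y)

  DesignIso : Subset → (Subset → Set (c ⊔ ℓ)) → (Subset → Set (c ⊔ ℓ)) → Set (lsuc (c ⊔ ℓ))
  DesignIso K B B′ =
    Σ (Carrier → Carrier) λ φ →
      (∀ x y → x ≈ y → φ x ≈ φ y) ×
      (∀ x y → φ (x + y) ≈ φ x + φ y) ×
      (∀ a x → K a → φ (a * x) ≈ a * φ x) ×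
      (∀ x y → φ x ≈ φ y → x ≈ y) ×
      (∀ y → ∃[ x ] (φ x ≈ y)) ×
      (∀ (W : Subset) → Respects W →
         (B W → B′ (image φ W)) × (B′ (image φ W) → B W))

-- If β is a Galois conjugate of α over K, then β = σ α for a field automorphism
-- σ of F fixing K.  Such a σ is in particular a K-linear bijection F → F, and
-- the whole statement is that σ itself witnesses both claims:
--   * F = K(β): the preimage under σ of a subfield L ∋ β containing K is a
--     subfield containing K and α, hence all of F; so L is all of F.
--   * σ maps α-splitting r-dimensional subspaces onto β-splitting ones: σ
--     preserves subspaces and bases, and σ (Σ αⁱ wᵢ) = Σ βⁱ σ(wᵢ), so a
--     decomposition F = ⊕ αⁱ W is carried to F = ⊕ βⁱ σ(W).  The converse
--     direction is the same transport along the inverse automorphism σ⁻¹.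
module Submission where

open import Defs
open import Data.Nat using (ℕ; _^_; zero; suc)
open import Data.Fin using (Fin; toℕ) renaming (zero to fzero; suc to fsuc)
open import Data.Product using (_×_; _,_; proj₁; proj₂; ∃-syntax)
open import Function using (_∘_)
open import Level using (_⊔_)
open import Relation.Nullary using (¬_)

module _ {c ℓ} (F : Field c ℓ) where
  open Field F
  open import Relation.Binary.Reasoning.Setoid setoid

  sumF-cong : ∀ {m} {f g : Fin m → Carrier} → (∀ i → f i ≈ g i) → sumF F f ≈ sumF F g
  sumF-cong {zero}  f≈g = refl
  sumF-cong {suc m} f≈g = +-cong (f≈g fzero) (sumF-cong (f≈g ∘ fsuc))

  pow-cong : ∀ {a b} k → a ≈ b → pow F a k ≈ pow F b k
  pow-cong zero    a≈b = refl
  pow-cong (suc k) a≈b = *-cong a≈b (pow-cong k a≈b)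

  record IsImage (φ : Carrier → Carrier) (W W′ : Subset F) : Set (c ⊔ ℓ) where
    field
      respects  : Respects F W′
      maps-into : ∀ x → W x → W′ (φ x)
      preimage  : ∀ y → W′ y → ∃[ x ] (W x × φ x ≈ y)

  image-isImage : (φ : Carrier → Carrier) (W : Subset F) → IsImage φ W (image F φ W)
  image-isImage φ W = record
    { respects  = λ { y≈y′ (x , wx , φx≈y) → x , wx , trans φx≈y y≈y′ }
    ; maps-into = λ x wx → x , wx , refl
    ; preimage  = λ y wy → wy
    }

  module _ (K : Subset F) where

    record KAutomorphism : Set (c ⊔ ℓ) where
      field
        σ            : Carrier → Carrier
        σ-cong       : ∀ x y → x ≈ y → σ x ≈ σ y
        σ-+          : ∀ x y → σ (x + y) ≈ σ x + σ y
        σ-*          : ∀ x y → σ (x * y) ≈ σ x * σ y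
        σ-1          : σ 1# ≈ 1#
        σ-injective  : ∀ x y → σ x ≈ σ y → x ≈ y
        σ-surjective : ∀ y → ∃[ x ] (σ x ≈ y)
        σ-fixes-K    : ∀ x → K x → σ x ≈ x

      -- An additive map sends 0 to 0 (cancel σ 0 from σ 0 + σ 0 = σ 0).
      σ-0 : σ 0# ≈ 0#
      σ-0 = begin
        σ 0#                      ≈⟨ sym (+-identityʳ _) ⟩
        σ 0# + 0#                 ≈⟨ +-congˡ (sym (-‿inverseʳ (σ 0#))) ⟩
        σ 0# + (σ 0# + - σ 0#)    ≈⟨ sym (+-assoc _ _ _) ⟩
        (σ 0# + σ 0#) + - σ 0#    ≈⟨ +-congʳ (sym (σ-+ 0# 0#)) ⟩
        σ (0# + 0#) + - σ 0#      ≈⟨ +-congʳ (σ-cong _ _ (+-identityʳ 0#)) ⟩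
        σ 0# + - σ 0#             ≈⟨ -‿inverseʳ _ ⟩
        0#                        ∎

      σ-neg : ∀ x → σ (- x) ≈ - σ x
      σ-neg x = begin
        σ (- x)                   ≈⟨ sym (+-identityˡ _) ⟩
        0# + σ (- x)              ≈⟨ +-congʳ (sym (-‿inverseˡ (σ x))) ⟩
        (- σ x + σ x) + σ (- x)   ≈⟨ +-assoc _ _ _ ⟩
        - σ x + (σ x + σ (- x))   ≈⟨ +-congˡ (sym (σ-+ x (- x))) ⟩
        - σ x + σ (x + - x)       ≈⟨ +-congˡ (trans (σ-cong _ _ (-‿inverseʳ x)) σ-0) ⟩
        - σ x + 0#                ≈⟨ +-identityʳ _ ⟩
        - σ x                     ∎

      σ-pow : ∀ a k → σ (pow F a k) ≈ pow F (σ a) k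
      σ-pow a zero    = σ-1
      σ-pow a (suc k) = trans (σ-* a _) (*-congˡ (σ-pow a k))

      σ-sum : ∀ {m} (f : Fin m → Carrier) → σ (sumF F f) ≈ sumF F (σ ∘ f)
      σ-sum {zero}  f = σ-0
      σ-sum {suc m} f = trans (σ-+ _ _) (+-congˡ (σ-sum (f ∘ fsuc)))

      σ-K-linear : ∀ a x → K a → σ (a * x) ≈ a * σ x
      σ-K-linear a x ka = trans (σ-* a x) (*-congʳ (σ-fixes-K a ka))

      σ-K-combination : ∀ {m} (a b : Fin m → Carrier) → (∀ i → K (a i)) →
        σ (sumF F (λ i → a i * b i)) ≈ sumF F (λ i → a i * σ (b i))
      σ-K-combination a b ka =
        trans (σ-sum (λ i → a i * b i)) (sumF-cong (λ i → σ-K-linear (a i) (b i) (ka i)))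

      σ-power-combination : ∀ {m α β} → β ≈ σ α → (w : Fin m → Carrier) →
        σ (sumF F (λ i → pow F α (toℕ i) * w i)) ≈ sumF F (λ i → pow F β (toℕ i) * σ (w i))
      σ-power-combination {α = α} {β} β≈σα w = trans (σ-sum (λ i → pow F α (toℕ i) * w i)) (sumF-cong power-term)
        where
        power-term : ∀ i → σ (pow F α (toℕ i) * w i) ≈ pow F β (toℕ i) * σ (w i)
        power-term i = trans (σ-* _ _)
          (*-congʳ (trans (σ-pow α (toℕ i)) (sym (pow-cong (toℕ i) β≈σα))))

      σ⁻¹ : Carrier → Carrier
      σ⁻¹ y = proj₁ (σ-surjective y)

      σσ⁻¹ : ∀ y → σ (σ⁻¹ y) ≈ y
      σσ⁻¹ y = proj₂ (σ-surjective y)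

      σ⁻¹σ : ∀ x → σ⁻¹ (σ x) ≈ x
      σ⁻¹σ x = σ-injective _ _ (σσ⁻¹ (σ x))

      σ⁻¹-cong : ∀ x y → x ≈ y → σ⁻¹ x ≈ σ⁻¹ y
      σ⁻¹-cong x y x≈y = σ-injective _ _ (trans (σσ⁻¹ x) (trans x≈y (sym (σσ⁻¹ y))))

      inverse-automorphism : KAutomorphism
      inverse-automorphism = record
        { σ            = σ⁻¹
        ; σ-cong       = σ⁻¹-cong
        ; σ-+          = λ x y → σ-injective _ _
            (trans (σσ⁻¹ _) (sym (trans (σ-+ _ _) (+-cong (σσ⁻¹ x) (σσ⁻¹ y)))))
        ; σ-*          = λ x y → σ-injective _ _
            (trans (σσ⁻¹ _) (sym (trans (σ-* _ _) (*-cong (σσ⁻¹ x) (σσ⁻¹ y)))))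
        ; σ-1          = σ-injective _ _ (trans (σσ⁻¹ _) (sym σ-1))
        ; σ-injective  = λ x y e → trans (sym (σσ⁻¹ x)) (trans (σ-cong _ _ e) (σσ⁻¹ y))
        ; σ-surjective = λ y → σ y , σ⁻¹σ y
        ; σ-fixes-K    = λ x kx → σ-injective _ _ (trans (σσ⁻¹ x) (sym (σ-fixes-K x kx)))
        }

      inverse-isImage : (W : Subset F) → Respects F W → IsImage σ⁻¹ (image F σ W) W
      inverse-isImage W resp-W = record
        { respects  = resp-W
        ; maps-into = λ { y (x , wx , σx≈y) →
            resp-W (trans (sym (σ⁻¹σ x)) (σ⁻¹-cong _ _ σx≈y)) wx }
        ; preimage  = λ x wx → σ x , (x , wx , refl) , σ⁻¹σ x
        }

      preimage-subfield : (L : Subset F) → IsSubfield F L → IsSubfield F (L ∘ σ)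
      preimage-subfield L (resp , L0 , L1 , L+ , L* , L- , L-inv) =
          (λ x≈y → resp (σ-cong _ _ x≈y))
        , resp (sym σ-0) L0
        , resp (sym σ-1) L1
        , (λ x y lx ly → resp (sym (σ-+ x y)) (L+ _ _ lx ly))
        , (λ x y lx ly → resp (sym (σ-* x y)) (L* _ _ lx ly))
        , (λ x lx → resp (sym (σ-neg x)) (L- _ lx))
        , inverse-in-preimage
        where
        inverse-in-preimage : ∀ x → L (σ x) → ¬ (x ≈ 0#) → ∃[ y ] (L (σ y) × x * y ≈ 1#)
        inverse-in-preimage x lσx x≉0
          with L-inv (σ x) lσx (λ σx≈0 → x≉0 (σ-injective _ _ (trans σx≈0 (sym σ-0))))
        ... | y′ , ly′ , σx*y′≈1 =
          σ⁻¹ y′ , resp (sym (σσ⁻¹ y′)) ly′ ,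
          σ-injective _ _ (trans (σ-* _ _) (trans (*-congˡ (σσ⁻¹ y′)) (trans σx*y′≈1 (sym σ-1))))

      -- If F = K(α) and β = σ α then F = K(β): a subfield L ⊇ K with β ∈ L pulls
      -- back along σ to a subfield containing K and α, so σ⁻¹ y ∈ L ∘ σ for all y.
      generates-image : ∀ {α β} → β ≈ σ α → Generates F K α → Generates F K β
      generates-image β≈σα gen-α L L-subfield K⊆L lβ y =
        resp (σσ⁻¹ y) (gen-α (L ∘ σ) (preimage-subfield L L-subfield)
                        (λ x kx → resp (sym (σ-fixes-K x kx)) (K⊆L x kx))
                        (resp β≈σα lβ) (σ⁻¹ y))
        where
        resp : Respects F L
        resp = proj₁ L-subfield

    module Transport (A : KAutomorphism) {W W′ : Subset F} (im : IsImage (KAutomorphism.σ A) W W′) where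
      open KAutomorphism A
      open IsImage im

      pre : ∀ {y} → W′ y → Carrier
      pre {y} wy = proj₁ (preimage y wy)

      pre-in : ∀ {y} (wy : W′ y) → W (pre wy)
      pre-in {y} wy = proj₁ (proj₂ (preimage y wy))

      pre-eq : ∀ {y} (wy : W′ y) → σ (pre wy) ≈ y
      pre-eq {y} wy = proj₂ (proj₂ (preimage y wy))

      subspace : IsSubspace F K W → IsSubspace F K W′
      subspace (_ , W0 , W+ , W*) = respects , respects σ-0 (maps-into _ W0) , closed-+ , closed-*
        where
        closed-+ : ∀ y y′ → W′ y → W′ y′ → W′ (y + y′)
        closed-+ y y′ wy wy′ = respects (trans (σ-+ _ _) (+-cong (pre-eq wy) (pre-eq wy′)))
                                        (maps-into _ (W+ _ _ (pre-in wy) (pre-in wy′)))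
        closed-* : ∀ a y → K a → W′ y → W′ (a * y)
        closed-* a y ka wy = respects (trans (σ-K-linear a _ ka) (*-congˡ (pre-eq wy)))
                                      (maps-into _ (W* a _ ka (pre-in wy)))

      dimension : ∀ {r} → HasDim F K W r → HasDim F K W′ r
      dimension {r} (b , bW , independent , spanning) =
        σ ∘ b , (λ i → maps-into _ (bW i)) , independent′ , spanning′
        where
        independent′ : ∀ (a : Fin r → Carrier) → (∀ i → K (a i)) →
          sumF F (λ i → a i * σ (b i)) ≈ 0# → ∀ i → a i ≈ 0#
        independent′ a ka sum≈0 = independent a ka
          (σ-injective _ _ (trans (σ-K-combination a b ka) (trans sum≈0 (sym σ-0))))
        spanning′ : ∀ y → W′ y → ∃[ a ] ((∀ i → K (a i)) × y ≈ sumF F (λ i → a i * σ (b i)))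
        spanning′ y wy with spanning (pre wy) (pre-in wy)
        ... | a , ka , x≈sum = a , ka ,
          trans (sym (pre-eq wy)) (trans (σ-cong _ _ x≈sum) (σ-K-combination a b ka))

      splitting : ∀ {n α β} → β ≈ σ α → IsSplitting F n α W → IsSplitting F n β W′
      splitting {n} {α} {β} β≈σα (decompose , unique) = decompose′ , unique′
        where
        decompose′ : ∀ y → ∃[ w ] ((∀ i → W′ (w i)) × y ≈ sumF F (λ i → pow F β (toℕ i) * w i))
        decompose′ y with decompose (σ⁻¹ y)
        ... | w , wW , σ⁻¹y≈sum = σ ∘ w , (λ i → maps-into _ (wW i)) ,
          trans (sym (σσ⁻¹ y)) (trans (σ-cong _ _ σ⁻¹y≈sum) (σ-power-combination β≈σα w))

        -- Pull both expansions back to W, compare there, and push forward.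
        unique′ : ∀ (w w′ : Fin n → Carrier) → (∀ i → W′ (w i)) → (∀ i → W′ (w′ i)) →
          sumF F (λ i → pow F β (toℕ i) * w i) ≈ sumF F (λ i → pow F β (toℕ i) * w′ i) →
          ∀ i → w i ≈ w′ i
        unique′ w w′ ww ww′ sums≈ i =
          trans (sym (pre-eq (ww i))) (trans (σ-cong _ _ (same-preimages i)) (pre-eq (ww′ i)))
          where
          u u′ : Fin n → Carrier
          u  j = pre (ww j)
          u′ j = pre (ww′ j)
          same-preimages : ∀ j → u j ≈ u′ j
          same-preimages = unique u u′ (λ j → pre-in (ww j)) (λ j → pre-in (ww′ j))
            (σ-injective _ _ (begin
              σ (sumF F (λ j → pow F α (toℕ j) * u j))   ≈⟨ σ-power-combination β≈σα u ⟩
              sumF F (λ j → pow F β (toℕ j) * σ (u j))   ≈⟨ sumF-cong (λ j → *-congˡ (pre-eq (ww j))) ⟩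
              sumF F (λ j → pow F β (toℕ j) * w j)       ≈⟨ sums≈ ⟩
              sumF F (λ j → pow F β (toℕ j) * w′ j)      ≈⟨ sumF-cong (λ j → *-congˡ (sym (pre-eq (ww′ j)))) ⟩
              sumF F (λ j → pow F β (toℕ j) * σ (u′ j))  ≈⟨ sym (σ-power-combination β≈σα u′) ⟩
              σ (sumF F (λ j → pow F α (toℕ j) * u′ j))  ∎))

      block : ∀ {n r α β} → β ≈ σ α → SplittingBlock F K n r α W → SplittingBlock F K n r β W′
      block β≈σα (sub , dim , spl) = subspace sub , dimension dim , splitting β≈σα spl

    automorphism-designIso : (A : KAutomorphism) → ∀ {n r α β} → β ≈ KAutomorphism.σ A α →
      DesignIso F K (SplittingBlock F K n r α) (SplittingBlock F K n r β)
    automorphism-designIso A {n} {r} {α} {β} β≈σα =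
      σ , σ-cong , σ-+ , σ-K-linear , σ-injective , σ-surjective , blocks
      where
      open KAutomorphism A
      α≈σ⁻¹β : α ≈ σ⁻¹ β
      α≈σ⁻¹β = sym (trans (σ⁻¹-cong _ _ β≈σα) (σ⁻¹σ α))
      blocks : ∀ (W : Subset F) → Respects F W →
        (SplittingBlock F K n r α W → SplittingBlock F K n r β (image F σ W)) ×
        (SplittingBlock F K n r β (image F σ W) → SplittingBlock F K n r α W)
      blocks W resp-W =
          Transport.block A (image-isImage σ W) β≈σα
        , Transport.block inverse-automorphism (inverse-isImage W resp-W) α≈σ⁻¹β

    conjugating-automorphism : ∀ {α β} → IsGaloisConjugate F K α β → KAutomorphism
    conjugating-automorphism (σ , σ-cong , σ-+ , σ-* , σ-1 , σ-inj , σ-surj , σ-fix , _) = record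
      { σ = σ ; σ-cong = σ-cong ; σ-+ = σ-+ ; σ-* = σ-* ; σ-1 = σ-1
      ; σ-injective = σ-inj ; σ-surjective = σ-surj ; σ-fixes-K = σ-fix }

corollary1 : ∀ {c ℓ} (F : Field c ℓ) (q n r : ℕ) (K : Subset F) →
    IsPrimePower q → IsSubfield F K → HasSize F K q → FieldHasSize F (q ^ n) →
    (α : Field.Carrier F) → Generates F K α →
    (β : Field.Carrier F) → IsGaloisConjugate F K α β →
    Generates F K β ×
    DesignIso F K (SplittingBlock F K n r α) (SplittingBlock F K n r β)
corollary1 F q n r K _ _ _ _ α gen-α β conjugate@(_ , _ , _ , _ , _ , _ , _ , _ , β≈σα) =
    KAutomorphism.generates-image σ β≈σα gen-α
  , automorphism-designIso F K σ β≈σα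
  where
  σ = conjugating-automorphism F K conjugate
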